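{- Let $S_1$ be a $k_1$-spanner and set $G_1=S_1$. For $n\ge 1$, let $G_{n+1}$ be obtained from $G_n$ by taking a new $k_{n+1}$-spanner $S_{n+1}$ (vertex-disjoint from $G_n$, $k_{n+1}\ge 0$) and adding one edge joining a central vertex of some $S_j$, $j\le n$, to a central vertex of $S_{n+1}$. Then for every $m\ge 1$ and every $(H,H')\in\Lambda_\mu(G_m)$, we have $(H\cap E(S_n), H'\cap E(S_n))\in\Lambda_\mu(S_n)$ for each $n\le m$.
   Context: All graphs are finite, simple, undirected and loopless. $\lambda(G)=\max\{|H|+|H'| : H,H' \text{ are disjoint matchings in } G\}$, $\Lambda(G)$ is the set of ordered pairs $(H,H')$ of disjoint matchings of $G$ with $|H|+|H'|=\lambda(G)$, $\mu(G)=\max\{|H| : (H,H')\in\Lambda(G)\}$, and $\Lambda_\mu(G)$ is the set of $(H,H')\in\Lambda(G)$ with $|H|=\mu(G)$. A leg attached at a vertex $c$ is a path $c\,x\,y$ with $x,y$ new vertices. For an integer $k\ge 0$, a $k$-spanner is the tree obtained from two vertices $c_1,c_2$ (the central vertices) joined by an edge, by attaching $p\ge 2$ legs at $c_1$ and $q\ge 2$ legs at $c_2$, with $p+q=k+4$ (all leg vertices distinct). -}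

module Defs where

open import Data.Nat using (ℕ; zero; suc; _+_; _≤_)
open import Data.Bool using (Bool; true; false)
open import Data.Product using (_×_; _,_)
open import Data.List using (List; []; _∷_; _++_; length; concatMap; filter)
open import Data.List.Membership.Propositional using (_∈_; _∉_)
open import Data.List.Relation.Unary.All using (All)
open import Data.List.Relation.Unary.AllPairs using (AllPairs)
open import Data.List.Relation.Unary.Unique.Propositional using (Unique)
open import Relation.Binary.PropositionalEquality using (_≡_; _≢_)
import Data.List.Membership.DecPropositional as DecMem
open import Data.Product.Properties using (≡-dec)
import Data.Nat.Properties as ℕP

-- Vertices are labelled by natural numbers; a graph is given by its edge list
-- (isolated vertices are irrelevant for matchings).  Edges are ordered pairs;
-- all graphs constructed below are simple, so each undirected edge occurs once.
Vertex : Set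
Vertex = ℕ

Edge : Set
Edge = Vertex × Vertex

Graph : Set
Graph = List Edge

VDisjoint : Edge → Edge → Set
VDisjoint (a , b) (c , d) = (a ≢ c) × (a ≢ d) × (b ≢ c) × (b ≢ d)

-- a matching of G: a list of edges of G, pairwise vertex-disjoint
-- (hence without repetitions, so its length is its cardinality)
IsMatching : Graph → List Edge → Set
IsMatching G H = All (_∈ G) H × AllPairs VDisjoint H

DisjointMatchings : Graph → List Edge → List Edge → Set
DisjointMatchings G H H' =
  IsMatching G H × IsMatching G H' × (∀ e → e ∈ H → e ∉ H')

-- (H , H') ∈ Λ(G): |H| + |H'| = λ(G)
InΛ : Graph → List Edge → List Edge → Set
InΛ G H H' = DisjointMatchings G H H' ×
  (∀ K K' → DisjointMatchings G K K' → length K + length K' ≤ length H + length H')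

-- (H , H') ∈ Λ_μ(G): in Λ(G) and |H| = μ(G)
InΛμ : Graph → List Edge → List Edge → Set
InΛμ G H H' = InΛ G H H' × (∀ K K' → InΛ G K K' → length K ≤ length H)

_∩E_ : List Edge → Graph → List Edge
H ∩E F = filter (λ e → DecMem._∈?_ (≡-dec ℕP._≟_ ℕP._≟_) e F) H

-- A spanner: central vertices c₁ c₂ (joined by an edge) and legs c x y given by
-- the pairs (x , y) attached at c₁ (legs₁) and at c₂ (legs₂).
record Spanner : Set where
  field
    c₁ c₂ : Vertex
    legs₁ legs₂ : List (Vertex × Vertex)

legVerts : List (Vertex × Vertex) → List Vertex
legVerts = concatMap (λ { (x , y) → x ∷ y ∷ [] })

legEdges : Vertex → List (Vertex × Vertex) → List Edge
legEdges c = concatMap (λ { (x , y) → (c , x) ∷ (x , y) ∷ [] })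

vertices : Spanner → List Vertex
vertices S = Spanner.c₁ S ∷ Spanner.c₂ S ∷ (legVerts (Spanner.legs₁ S) ++ legVerts (Spanner.legs₂ S))

edges : Spanner → Graph
edges S = (Spanner.c₁ S , Spanner.c₂ S) ∷
  (legEdges (Spanner.c₁ S) (Spanner.legs₁ S) ++ legEdges (Spanner.c₂ S) (Spanner.legs₂ S))

IsSpanner : ℕ → Spanner → Set
IsSpanner k S =
  (2 ≤ length (Spanner.legs₁ S)) × (2 ≤ length (Spanner.legs₂ S)) ×
  (length (Spanner.legs₁ S) + length (Spanner.legs₂ S) ≡ k + 4) ×
  Unique (vertices S)

central : Spanner → Bool → Vertex
central S false = Spanner.c₁ S
central S true  = Spanner.c₂ S

-- The construction (0-indexed: S 0 is the paper's S_1, G 0 the paper's G_1).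
record SpannerChain : Set where
  field
    S        : ℕ → Spanner
    k        : ℕ → ℕ
    spanner  : ∀ n → IsSpanner (k n) (S n)
    disjoint : ∀ i j → i ≢ j → ∀ v → v ∈ vertices (S i) → v ∉ vertices (S j)
    attach   : ℕ → ℕ
    attach≤  : ∀ n → attach n ≤ n
    side     : ℕ → Bool
    side'    : ℕ → Bool

chainGraph : SpannerChain → ℕ → Graph
chainGraph C zero = edges (SpannerChain.S C 0)
chainGraph C (suc n) =
  chainGraph C n ++
  ((central (SpannerChain.S C (SpannerChain.attach C n)) (SpannerChain.side C n) ,
    central (SpannerChain.S C (suc n)) (SpannerChain.side' C n))
   ∷ edges (SpannerChain.S C (suc n)))

module Submission where

-- A pendant leg u–x–y (x has only the neighbours u
--     and y, y only the neighbour x) lets us enlarge |H| + |H'| by one whenever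
--     u is not covered by H: put ux into H and xy into H'.  If an edge uv between
--     two vertices carrying two pendant legs each lay in H, deleting it and then
--     augmenting at u and at v would gain one in total, contradicting
--     |H| + |H'| = λ(G).  Central vertices of spanners carry two legs, so every
--     edge of H or H' for (H , H') ∈ Λ(G_m) lies inside a single spanner.
-- (2) Restriction to a separated subgraph.  If F ⊆ G and the edges of H ∪ H'
--     outside F are vertex-disjoint from the edges of F, then any pair (K , K')
--     of disjoint matchings of F can replace (H ∩ F , H' ∩ F) inside (H , H');
--     comparing sizes, (H , H') ∈ Λ_μ(G) gives (H ∩ F , H' ∩ F) ∈ Λ_μ(F).

open import Data.Nat using (ℕ; zero; suc; _+_; _≤_; z≤n; s≤s)
import Data.Nat.Properties as ℕP
open import Algebra.Properties.CommutativeSemigroup ℕP.+-commutativeSemigroup using (interchange)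
open import Data.Bool using (Bool; true; false)
open import Data.Product using (Σ; ∃-syntax; _×_; _,_; proj₁; proj₂)
open import Data.Sum using (_⊎_; inj₁; inj₂)
open import Data.Empty using (⊥; ⊥-elim)
open import Data.List using (List; []; _∷_; _++_; length; filter)
open import Data.List.Properties using (length-++)
open import Data.List.Membership.Propositional using (_∈_; _∉_)
open import Data.List.Membership.Propositional.Properties using (∈-++⁺ˡ; ∈-++⁺ʳ; ∈-++⁻; ∈-filter⁻)
open import Data.List.Relation.Unary.Any using (here; there)
open import Data.List.Relation.Unary.All as All using (All; []; _∷_)
open import Data.List.Relation.Unary.AllPairs using (AllPairs; []; _∷_)
import Data.List.Relation.Unary.AllPairs.Properties as AllPairs
open import Data.List.Relation.Unary.Unique.Propositional using (Unique)
open import Relation.Binary.PropositionalEquality using (_≡_; _≢_; refl; sym; trans; cong; cong₂; subst; subst₂)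
open import Relation.Binary.Definitions using (DecidableEquality)
open import Relation.Nullary using (yes; no; ¬?)
open import Data.Product.Properties using (≡-dec)
import Data.List.Membership.DecPropositional as DecMem
open import Defs

_≟ₑ_ : DecidableEquality Edge
_≟ₑ_ = ≡-dec ℕP._≟_ ℕP._≟_

open DecMem _≟ₑ_ using (_∈?_)

touches : Vertex → Edge → Set
touches w e = w ≡ proj₁ e ⊎ w ≡ proj₂ e

vdisjoint-elim : ∀ e f {w} → VDisjoint e f → touches w e → touches w f → ⊥
vdisjoint-elim (a , b) (c , d) (p , q , r , s) (inj₁ refl) (inj₁ refl) = p refl
vdisjoint-elim (a , b) (c , d) (p , q , r , s) (inj₁ refl) (inj₂ refl) = q refl
vdisjoint-elim (a , b) (c , d) (p , q , r , s) (inj₂ refl) (inj₁ refl) = r refl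
vdisjoint-elim (a , b) (c , d) (p , q , r , s) (inj₂ refl) (inj₂ refl) = s refl

vdisjoint-intro : ∀ e f → (∀ w → touches w e → touches w f → ⊥) → VDisjoint e f
vdisjoint-intro (a , b) (c , d) h =
  (λ eq → h a (inj₁ refl) (inj₁ eq)) , (λ eq → h a (inj₁ refl) (inj₂ eq)) ,
  (λ eq → h b (inj₂ refl) (inj₁ eq)) , (λ eq → h b (inj₂ refl) (inj₂ eq))

vdisjoint-irrefl : ∀ e → VDisjoint e e → ⊥
vdisjoint-irrefl e vd = vdisjoint-elim e e vd (inj₁ refl) (inj₁ refl)

pairwise : ∀ {A : Set} {R : A → A → Set} {xs a b} →
  AllPairs R xs → a ∈ xs → b ∈ xs → a ≢ b → R a b ⊎ R b a
pairwise (p ∷ ps) (here refl) (here refl) a≢b = ⊥-elim (a≢b refl)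
pairwise (p ∷ ps) (here refl) (there j) _ = inj₁ (All.lookup p j)
pairwise (p ∷ ps) (there i) (here refl) _ = inj₂ (All.lookup p i)
pairwise (p ∷ ps) (there i) (there j) a≢b = pairwise ps i j a≢b

AllPairs-++⁻ : ∀ {A : Set} {R : A → A → Set} xs {ys} → AllPairs R (xs ++ ys) →
  AllPairs R xs × AllPairs R ys × (∀ {a b} → a ∈ xs → b ∈ ys → R a b)
AllPairs-++⁻ [] ap = [] , ap , λ ()
AllPairs-++⁻ (x ∷ xs) (px ∷ ap) with AllPairs-++⁻ xs ap
... | apxs , apys , across =
  All.tabulate (λ i → All.lookup px (∈-++⁺ˡ i)) ∷ apxs , apys , across′
  where
  across′ : ∀ {a b} → a ∈ x ∷ xs → b ∈ _ → _
  across′ (here refl) j = All.lookup px (∈-++⁺ʳ xs j)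
  across′ (there i) j = across i j

matching-at : ∀ {H r e w} → AllPairs VDisjoint H → r ∈ H → e ∈ H →
  touches w r → touches w e → r ≡ e
matching-at {r = r} {e} ap i j tr te with r ≟ₑ e
... | yes r≡e = r≡e
... | no r≢e with pairwise ap i j r≢e
...   | inj₁ vd = ⊥-elim (vdisjoint-elim r e vd tr te)
...   | inj₂ vd = ⊥-elim (vdisjoint-elim e r vd te tr)

swapΛ : ∀ G H H' → InΛ G H H' → InΛ G H' H
swapΛ G H H' ((m , m' , d) , opt) = (m' , m , λ e i j → d e j i) ,
  λ K K' (k , k' , dk) →
    subst₂ _≤_ (ℕP.+-comm (length K') (length K)) (ℕP.+-comm (length H) (length H'))
      (opt K' K (k' , k , λ e i j → dk e j i))

remove : Edge → List Edge → List Edge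
remove a [] = []
remove a (b ∷ L) with a ≟ₑ b
... | yes _ = remove a L
... | no _ = b ∷ remove a L

remove-⊆ : ∀ a L {r} → r ∈ remove a L → r ∈ L
remove-⊆ a (b ∷ L) i with a ≟ₑ b
... | yes _ = there (remove-⊆ a L i)
remove-⊆ a (b ∷ L) (here refl) | no _ = here refl
remove-⊆ a (b ∷ L) (there i) | no _ = there (remove-⊆ a L i)

remove-≢ : ∀ a L {r} → r ∈ remove a L → r ≢ a
remove-≢ a (b ∷ L) i with a ≟ₑ b
... | yes _ = remove-≢ a L i
remove-≢ a (b ∷ L) (here refl) | no a≢b = λ b≡a → a≢b (sym b≡a)
remove-≢ a (b ∷ L) (there i) | no _ = remove-≢ a L i

remove-matching : ∀ {G} a L → IsMatching G L → IsMatching G (remove a L)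
remove-matching a [] m = m
remove-matching a (b ∷ L) (b∈G ∷ L⊆G , pb ∷ ps) with a ≟ₑ b
... | yes _ = remove-matching a L (L⊆G , ps)
... | no _ =
  let (L⊆G′ , ps′) = remove-matching a L (L⊆G , ps)
  in b∈G ∷ L⊆G′ , All.tabulate (λ i → All.lookup pb (remove-⊆ a L i)) ∷ ps′

length-remove-∉ : ∀ a L → a ∉ L → length (remove a L) ≡ length L
length-remove-∉ a [] _ = refl
length-remove-∉ a (b ∷ L) a∉ with a ≟ₑ b
... | yes refl = ⊥-elim (a∉ (here refl))
... | no _ = cong suc (length-remove-∉ a L (λ i → a∉ (there i)))

length-remove : ∀ a L → AllPairs VDisjoint L → length L ≤ suc (length (remove a L))
length-remove a [] [] = z≤n
length-remove a (b ∷ L) (pb ∷ ps) with a ≟ₑ b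
... | yes refl = ℕP.≤-reflexive
      (cong suc (sym (length-remove-∉ a L (λ i → vdisjoint-irrefl a (All.lookup pb i)))))
... | no _ = s≤s (length-remove a L ps)

Free : Vertex → List Edge → Set
Free w H = ∀ r → r ∈ H → touches w r → ⊥

record PendantLeg (G : Graph) (u x y : Vertex) : Set where
  field
    ux∈ : (u , x) ∈ G
    xy∈ : (x , y) ∈ G
    u≢x : u ≢ x
    at-x : ∀ r → r ∈ G → touches x r → r ≡ (u , x) ⊎ r ≡ (x , y)
    at-y : ∀ r → r ∈ G → touches y r → r ≡ (x , y)

Local : Graph → Graph → Vertex → Set
Local F G w = ∀ r → r ∈ G → touches w r → r ∈ F

pendant-extend : ∀ {F G u x y} → (∀ {r} → r ∈ F → r ∈ G) →
  Local F G x → Local F G y → PendantLeg F u x y → PendantLeg G u x y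
pendant-extend F⊆G local-x local-y leg = record
  { ux∈ = F⊆G ux∈
  ; xy∈ = F⊆G xy∈
  ; u≢x = u≢x
  ; at-x = λ r r∈G t → at-x r (local-x r r∈G t) t
  ; at-y = λ r r∈G t → at-y r (local-y r r∈G t) t
  }
  where open PendantLeg leg

record TwoLegs (G : Graph) (u : Vertex) : Set where
  field
    x₁ y₁ x₂ y₂ : Vertex
    x₁≢x₂ : x₁ ≢ x₂
    leg₁ : PendantLeg G u x₁ y₁
    leg₂ : PendantLeg G u x₂ y₂

record Improvement (G : Graph) (H H' : List Edge) (P : List Edge → Set) : Set where
  field
    K K' : List Edge
    matchings : DisjointMatchings G K K'
    larger : suc (length H + length H') ≤ length K + length K'
    property : P K

KeepsFree : List Vertex → List Edge → List Edge → Set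
KeepsFree X H K = ∀ w → w ∉ X → Free w H → Free w K

KeepsFree-mono : ∀ {X Y H K} → (∀ {w} → w ∈ X → w ∈ Y) → KeepsFree X H K → KeepsFree Y H K
KeepsFree-mono X⊆Y keeps w w∉Y = keeps w (λ w∈X → w∉Y (X⊆Y w∈X))

-- Augmentation along a pendant leg: if u is free in H and ux ∉ H', then
-- K = ux + (H - xy), K' = xy + (H' - xy) is larger, as xy lies in at most one of H, H'.
augment-leg : ∀ {G H H' u x y} → DisjointMatchings G H H' → Free u H → PendantLeg G u x y →
  (u , x) ∉ H' → Improvement G H H' (KeepsFree (u ∷ x ∷ []) H)
augment-leg {G} {H} {H'} {u} {x} {y} (mH , mH' , H∩H'≡∅) u-free leg ux∉H' = record
  { K = (u , x) ∷ remove (x , y) H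
  ; K' = (x , y) ∷ remove (x , y) H'
  ; matchings =
      (ux∈ ∷ proj₁ mK , All.tabulate (λ {r} i → vdisjoint-intro (u , x) r (ux-apart i)) ∷ proj₂ mK) ,
      (xy∈ ∷ proj₁ mK' , All.tabulate (λ {r} i → vdisjoint-intro (x , y) r (xy-apart i)) ∷ proj₂ mK') ,
      K∩K'≡∅
  ; larger = larger
  ; property = keeps
  }
  where
  open PendantLeg leg
  mK : IsMatching G (remove (x , y) H)
  mK = remove-matching (x , y) H mH
  mK' : IsMatching G (remove (x , y) H')
  mK' = remove-matching (x , y) H' mH'
  H-xy⊆H : ∀ {r} → r ∈ remove (x , y) H → r ∈ H
  H-xy⊆H = remove-⊆ (x , y) H
  H'-xy⊆H' : ∀ {r} → r ∈ remove (x , y) H' → r ∈ H'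
  H'-xy⊆H' = remove-⊆ (x , y) H'
  ux-apart : ∀ {r} → r ∈ remove (x , y) H → ∀ w → touches w (u , x) → touches w r → ⊥
  ux-apart i w (inj₁ refl) t = u-free _ (H-xy⊆H i) t
  ux-apart {r} i w (inj₂ refl) t with at-x r (All.lookup (proj₁ mH) (H-xy⊆H i)) t
  ... | inj₁ refl = u-free _ (H-xy⊆H i) (inj₁ refl)
  ... | inj₂ r≡xy = remove-≢ (x , y) H i r≡xy
  xy-apart : ∀ {r} → r ∈ remove (x , y) H' → ∀ w → touches w (x , y) → touches w r → ⊥
  xy-apart {r} i w (inj₁ refl) t with at-x r (All.lookup (proj₁ mH') (H'-xy⊆H' i)) t
  ... | inj₁ refl = ux∉H' (H'-xy⊆H' i)
  ... | inj₂ r≡xy = remove-≢ (x , y) H' i r≡xy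
  xy-apart {r} i w (inj₂ refl) t =
    remove-≢ (x , y) H' i (at-y r (All.lookup (proj₁ mH') (H'-xy⊆H' i)) t)
  K∩K'≡∅ : ∀ e → e ∈ (u , x) ∷ remove (x , y) H → e ∉ (x , y) ∷ remove (x , y) H'
  K∩K'≡∅ e (here refl) (here ux≡xy) = u≢x (cong proj₁ ux≡xy)
  K∩K'≡∅ e (here refl) (there j) = ux∉H' (H'-xy⊆H' j)
  K∩K'≡∅ e (there i) (here refl) = remove-≢ (x , y) H i refl
  K∩K'≡∅ e (there i) (there j) = H∩H'≡∅ e (H-xy⊆H i) (H'-xy⊆H' j)
  larger : suc (length H + length H') ≤ suc (length (remove (x , y) H)) + suc (length (remove (x , y) H'))
  larger with (x , y) ∈? H
  ... | yes xy∈H = s≤s (subst₂ _≤_ refl (sym (ℕP.+-suc _ _))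
        (ℕP.+-mono-≤ (length-remove (x , y) H (proj₂ mH))
          (ℕP.≤-reflexive (sym (length-remove-∉ (x , y) H' (H∩H'≡∅ _ xy∈H))))))
  ... | no xy∉H = s≤s (ℕP.+-mono-≤ (ℕP.≤-reflexive (sym (length-remove-∉ (x , y) H xy∉H)))
        (length-remove (x , y) H' (proj₂ mH')))
  keeps : KeepsFree (u ∷ x ∷ []) H ((u , x) ∷ remove (x , y) H)
  keeps w w∉ux w-free r (here refl) (inj₁ w≡u) = w∉ux (here w≡u)
  keeps w w∉ux w-free r (here refl) (inj₂ w≡x) = w∉ux (there (here w≡x))
  keeps w w∉ux w-free r (there i) t = w-free r (H-xy⊆H i) t

improvement-mono : ∀ {G H H' X Y} → (∀ {w} → w ∈ X → w ∈ Y) →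
  Improvement G H H' (KeepsFree X H) → Improvement G H H' (KeepsFree Y H)
improvement-mono X⊆Y imp =
  record { Improvement imp ; property = KeepsFree-mono X⊆Y (Improvement.property imp) }

-- With two legs at a free vertex u one of them has ux ∉ H', since H' covers u at most once.
augment-at : ∀ {G H H' u} → DisjointMatchings G H H' → Free u H → (L : TwoLegs G u) →
  Improvement G H H' (KeepsFree (u ∷ TwoLegs.x₁ L ∷ TwoLegs.x₂ L ∷ []) H)
augment-at {H' = H'} {u} dm u-free L with (u , TwoLegs.x₁ L) ∈? H'
... | no ux₁∉H' =
  improvement-mono (λ { (here e) → here e ; (there (here e)) → there (here e) })
    (augment-leg dm u-free (TwoLegs.leg₁ L) ux₁∉H')
... | yes ux₁∈H' =
  improvement-mono (λ { (here e) → here e ; (there (here e)) → there (there (here e)) })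
    (augment-leg dm u-free leg₂ ux₂∉H')
  where
  open TwoLegs L
  ux₂∉H' : (u , x₂) ∉ H'
  ux₂∉H' ux₂∈H' = x₁≢x₂ (cong proj₂
    (matching-at (proj₂ (proj₁ (proj₂ dm))) ux₁∈H' ux₂∈H' (inj₁ refl) (inj₁ refl)))

-- Deleting uv loses one; augmenting at u and then at v (still free) gains two.
bridge-unused : ∀ {G H H' u v} → InΛ G H H' → (Lu : TwoLegs G u) → TwoLegs G v →
  v ∉ u ∷ TwoLegs.x₁ Lu ∷ TwoLegs.x₂ Lu ∷ [] → (u , v) ∉ H
bridge-unused {G} {H} {H'} {u} {v} ((mH , mH' , H∩H'≡∅) , optimal) Lu Lv v∉legs uv∈H =
  ℕP.<-irrefl refl (ℕP.≤-trans gain (optimal _ _ (Improvement.matchings at-v)))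
  where
  H₀ : List Edge
  H₀ = remove (u , v) H
  dm₀ : DisjointMatchings G H₀ H'
  dm₀ = remove-matching (u , v) H mH , mH' , λ e i → H∩H'≡∅ e (remove-⊆ (u , v) H i)
  free-in-H₀ : ∀ {w} → touches w (u , v) → Free w H₀
  free-in-H₀ t r i tr =
    remove-≢ (u , v) H i (matching-at (proj₂ mH) (remove-⊆ (u , v) H i) uv∈H tr t)
  at-u : Improvement G H₀ H' (KeepsFree (u ∷ TwoLegs.x₁ Lu ∷ TwoLegs.x₂ Lu ∷ []) H₀)
  at-u = augment-at dm₀ (free-in-H₀ (inj₁ refl)) Lu
  at-v : Improvement G (Improvement.K at-u) (Improvement.K' at-u)
           (KeepsFree (v ∷ TwoLegs.x₁ Lv ∷ TwoLegs.x₂ Lv ∷ []) (Improvement.K at-u))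
  at-v = augment-at (Improvement.matchings at-u)
           (Improvement.property at-u v v∉legs (free-in-H₀ (inj₂ refl))) Lv
  gain : suc (length H + length H') ≤ length (Improvement.K at-v) + length (Improvement.K' at-v)
  gain = ℕP.≤-trans (s≤s (ℕP.+-monoˡ-≤ (length H') (length-remove (u , v) H (proj₂ mH))))
           (ℕP.≤-trans (s≤s (Improvement.larger at-u)) (Improvement.larger at-v))

outside : Graph → List Edge → List Edge
outside F = filter (λ e → ¬? (e ∈? F))

∩E-⊆ : ∀ F L {r} → r ∈ L ∩E F → r ∈ L × r ∈ F
∩E-⊆ F L = ∈-filter⁻ (_∈? F)

outside-⊆ : ∀ F L {r} → r ∈ outside F L → r ∈ L × r ∉ F
outside-⊆ F L = ∈-filter⁻ (λ e → ¬? (e ∈? F))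

length-split : ∀ F L → length L ≡ length (L ∩E F) + length (outside F L)
length-split F [] = refl
length-split F (e ∷ L) with e ∈? F
... | yes _ = cong suc (length-split F L)
... | no _ = trans (cong suc (length-split F L)) (sym (ℕP.+-suc _ _))

Separated : Graph → List Edge → Set
Separated F H = ∀ {a b} → a ∈ F → b ∈ outside F H → VDisjoint a b

module Restriction {F G : Graph} (F⊆G : ∀ {r} → r ∈ F → r ∈ G) {H H' : List Edge}
                   (sepH : Separated F H) (sepH' : Separated F H') where

  Hᵢ H'ᵢ Hₒ H'ₒ : List Edge
  Hᵢ = H ∩E F
  H'ᵢ = H' ∩E F
  Hₒ = outside F H
  H'ₒ = outside F H'

  restrict-matchings : DisjointMatchings G H H' → DisjointMatchings F Hᵢ H'ᵢ
  restrict-matchings ((_ , apH) , (_ , apH') , H∩H'≡∅) =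
    (All.tabulate (λ i → proj₂ (∩E-⊆ F H i)) , AllPairs.filter⁺ (_∈? F) apH) ,
    (All.tabulate (λ i → proj₂ (∩E-⊆ F H' i)) , AllPairs.filter⁺ (_∈? F) apH') ,
    λ e i j → H∩H'≡∅ e (proj₁ (∩E-⊆ F H i)) (proj₁ (∩E-⊆ F H' j))

  splice-matching : ∀ {K L} → IsMatching F K → IsMatching G L → Separated F L →
    IsMatching G (K ++ outside F L)
  splice-matching {K} {L} (K⊆F , apK) (L⊆G , apL) sepL =
    All.tabulate in-G ,
    AllPairs.++⁺ apK (AllPairs.filter⁺ (λ e → ¬? (e ∈? F)) apL)
      (All.tabulate (λ i → All.tabulate (sepL (All.lookup K⊆F i))))
    where
    in-G : ∀ {r} → r ∈ K ++ outside F L → r ∈ G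
    in-G i with ∈-++⁻ K i
    ... | inj₁ r∈K = F⊆G (All.lookup K⊆F r∈K)
    ... | inj₂ r∈Lₒ = All.lookup L⊆G (proj₁ (outside-⊆ F L r∈Lₒ))

  splice : DisjointMatchings G H H' → ∀ {K K'} → DisjointMatchings F K K' →
    DisjointMatchings G (K ++ Hₒ) (K' ++ H'ₒ)
  splice (mH , mH' , H∩H'≡∅) {K} {K'} (mK , mK' , K∩K'≡∅) =
    splice-matching mK mH sepH , splice-matching mK' mH' sepH' , disjoint
    where
    disjoint : ∀ e → e ∈ K ++ Hₒ → e ∉ K' ++ H'ₒ
    disjoint e i j with ∈-++⁻ K i | ∈-++⁻ K' j
    ... | inj₁ e∈K | inj₁ e∈K' = K∩K'≡∅ e e∈K e∈K'
    ... | inj₁ e∈K | inj₂ e∈H'ₒ = proj₂ (outside-⊆ F H' e∈H'ₒ) (All.lookup (proj₁ mK) e∈K)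
    ... | inj₂ e∈Hₒ | inj₁ e∈K' = proj₂ (outside-⊆ F H e∈Hₒ) (All.lookup (proj₁ mK') e∈K')
    ... | inj₂ e∈Hₒ | inj₂ e∈H'ₒ =
      H∩H'≡∅ e (proj₁ (outside-⊆ F H e∈Hₒ)) (proj₁ (outside-⊆ F H' e∈H'ₒ))

  size-splice : ∀ K K' → length (K ++ Hₒ) + length (K' ++ H'ₒ) ≡
    (length K + length K') + (length Hₒ + length H'ₒ)
  size-splice K K' = trans (cong₂ _+_ (length-++ K) (length-++ K'))
    (interchange (length K) (length Hₒ) (length K') (length H'ₒ))

  size-split : length H + length H' ≡ (length Hᵢ + length H'ᵢ) + (length Hₒ + length H'ₒ)
  size-split = trans (cong₂ _+_ (length-split F H) (length-split F H'))
    (interchange (length Hᵢ) (length Hₒ) (length H'ᵢ) (length H'ₒ))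

  -- λ(F) is attained by the restriction: a better pair for F would splice to a better pair for G
  restrict-Λ : InΛ G H H' → InΛ F Hᵢ H'ᵢ
  restrict-Λ (dm , optimal) = restrict-matchings dm , λ K K' dmK →
    ℕP.+-cancelʳ-≤ (length Hₒ + length H'ₒ) _ _
      (subst₂ _≤_ (size-splice K K') size-split (optimal _ _ (splice dm dmK)))

  -- μ(F) is attained as well: a pair in Λ(F) splices to a pair in Λ(G), so its first part is
  -- bounded by |H|
  restrict-Λμ : InΛμ G H H' → InΛμ F Hᵢ H'ᵢ
  restrict-Λμ ((dm , optimal) , μ-max) = restrict-Λ (dm , optimal) , λ K K' K∈Λ →
    ℕP.+-cancelʳ-≤ (length Hₒ) _ _
      (subst₂ _≤_ (length-++ K) (length-split F H) (μ-max _ _ (splice-Λ K∈Λ)))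
    where
    splice-Λ : ∀ {K K'} → InΛ F K K' → InΛ G (K ++ Hₒ) (K' ++ H'ₒ)
    splice-Λ {K} {K'} (dmK , optimalK) = splice dm dmK , λ L L' dmL →
      ℕP.≤-trans (optimal L L' dmL) (subst₂ _≤_ (sym size-split) (sym (size-splice K K'))
        (ℕP.+-monoˡ-≤ (length Hₒ + length H'ₒ) (optimalK _ _ (restrict-matchings dm))))

legVerts-∈ : ∀ {L x y} → (x , y) ∈ L → x ∈ legVerts L × y ∈ legVerts L
legVerts-∈ (here refl) = here refl , there (here refl)
legVerts-∈ (there k) with legVerts-∈ k
... | x∈ , y∈ = there (there x∈) , there (there y∈)

legEdges-∈ : ∀ c {L x y} → (x , y) ∈ L → (c , x) ∈ legEdges c L × (x , y) ∈ legEdges c L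
legEdges-∈ c (here refl) = here refl , there (here refl)
legEdges-∈ c (there k) with legEdges-∈ c k
... | cx∈ , xy∈ = there (there cx∈) , there (there xy∈)

legEdges-view : ∀ c L {r} → r ∈ legEdges c L →
  ∃[ a ] ∃[ b ] (a , b) ∈ L × (r ≡ (c , a) ⊎ r ≡ (a , b))
legEdges-view c ((a , b) ∷ L) (here refl) = a , b , here refl , inj₁ refl
legEdges-view c ((a , b) ∷ L) (there (here refl)) = a , b , here refl , inj₂ refl
legEdges-view c ((a , b) ∷ L) (there (there i)) with legEdges-view c L i
... | a′ , b′ , k , shape = a′ , b′ , there k , shape

leg-det : ∀ {L a b x y} → Unique (legVerts L) → (a , b) ∈ L → (x , y) ∈ L →
  a ≡ x ⊎ b ≡ y → (a , b) ≡ (x , y)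
leg-det _ (here refl) (here refl) _ = refl
leg-det ((_ ∷ p≢V) ∷ (q≢V ∷ _)) (here refl) (there k) (inj₁ p≡x) =
  ⊥-elim (All.lookup p≢V (proj₁ (legVerts-∈ k)) p≡x)
leg-det ((_ ∷ p≢V) ∷ (q≢V ∷ _)) (here refl) (there k) (inj₂ q≡y) =
  ⊥-elim (All.lookup q≢V (proj₂ (legVerts-∈ k)) q≡y)
leg-det ((_ ∷ p≢V) ∷ (q≢V ∷ _)) (there k) (here refl) (inj₁ a≡p) =
  ⊥-elim (All.lookup p≢V (proj₁ (legVerts-∈ k)) (sym a≡p))
leg-det ((_ ∷ p≢V) ∷ (q≢V ∷ _)) (there k) (here refl) (inj₂ b≡q) =
  ⊥-elim (All.lookup q≢V (proj₂ (legVerts-∈ k)) (sym b≡q))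
leg-det (_ ∷ (_ ∷ U)) (there k) (there k′) shared = leg-det U k k′ shared

leg-cross : ∀ {L a b x y} → Unique (legVerts L) → (a , b) ∈ L → (x , y) ∈ L → a ≢ y
leg-cross ((p≢q ∷ _) ∷ _) (here refl) (here refl) = p≢q
leg-cross ((_ ∷ p≢V) ∷ _) (here refl) (there k) = All.lookup p≢V (proj₂ (legVerts-∈ k))
leg-cross (_ ∷ (q≢V ∷ _)) (there k) (here refl) a≡q = All.lookup q≢V (proj₁ (legVerts-∈ k)) (sym a≡q)
leg-cross (_ ∷ (_ ∷ U)) (there k) (there k′) = leg-cross U k k′

two-legs : ∀ L → 2 ≤ length L → Unique (legVerts L) →
  ∃[ x₁ ] ∃[ y₁ ] ∃[ x₂ ] ∃[ y₂ ] x₁ ≢ x₂ × (x₁ , y₁) ∈ L × (x₂ , y₂) ∈ L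
two-legs [] () _
two-legs (_ ∷ []) (s≤s ()) _
two-legs ((a , b) ∷ (c , d) ∷ L) _ ((_ ∷ (a≢c ∷ _)) ∷ _) =
  a , b , c , d , a≢c , here refl , there (here refl)

legsAt : Spanner → Bool → List (Vertex × Vertex)
legsAt S false = Spanner.legs₁ S
legsAt S true = Spanner.legs₂ S

central-∈ : ∀ S s → central S s ∈ vertices S
central-∈ S false = here refl
central-∈ S true = there (here refl)

unique-parts : ∀ {a b : Vertex} {V} → Unique (a ∷ b ∷ V) →
  All (a ≢_) (b ∷ V) × All (b ≢_) V × Unique V
unique-parts (a≢ ∷ (b≢ ∷ U)) = a≢ , b≢ , U

module SpannerStructure (S : Spanner) (U : Unique (vertices S)) where
  open Spanner S

  legVerts-⊆ : ∀ s {w} → w ∈ legVerts (legsAt S s) → w ∈ vertices S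
  legVerts-⊆ false w∈ = there (there (∈-++⁺ˡ w∈))
  legVerts-⊆ true w∈ = there (there (∈-++⁺ʳ (legVerts legs₁) w∈))

  legEdges-⊆ : ∀ s {r} → r ∈ legEdges (central S s) (legsAt S s) → r ∈ edges S
  legEdges-⊆ false r∈ = there (∈-++⁺ˡ r∈)
  legEdges-⊆ true r∈ = there (∈-++⁺ʳ (legEdges c₁ legs₁) r∈)

  private
    c₁≢ : All (c₁ ≢_) (c₂ ∷ legVerts legs₁ ++ legVerts legs₂)
    c₁≢ = proj₁ (unique-parts U)
    c₂≢ : All (c₂ ≢_) (legVerts legs₁ ++ legVerts legs₂)
    c₂≢ = proj₁ (proj₂ (unique-parts U))
    legs-split : Unique (legVerts legs₁) × Unique (legVerts legs₂) ×
                 (∀ {a b} → a ∈ legVerts legs₁ → b ∈ legVerts legs₂ → a ≢ b)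
    legs-split = AllPairs-++⁻ (legVerts legs₁) (proj₂ (proj₂ (unique-parts U)))

  legs-unique : ∀ s → Unique (legVerts (legsAt S s))
  legs-unique false = proj₁ legs-split
  legs-unique true = proj₁ (proj₂ legs-split)

  side-det : ∀ s s' {w} → w ∈ legVerts (legsAt S s) → w ∈ legVerts (legsAt S s') → s ≡ s'
  side-det false false _ _ = refl
  side-det false true w∈₁ w∈₂ = ⊥-elim (proj₂ (proj₂ legs-split) w∈₁ w∈₂ refl)
  side-det true false w∈₂ w∈₁ = ⊥-elim (proj₂ (proj₂ legs-split) w∈₁ w∈₂ refl)
  side-det true true _ _ = refl

  not-central : ∀ s s' {w} → w ∈ legVerts (legsAt S s) → w ≢ central S s'
  not-central false false w∈ w≡c₁ = All.lookup c₁≢ (there (∈-++⁺ˡ w∈)) (sym w≡c₁)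
  not-central true false w∈ w≡c₁ = All.lookup c₁≢ (there (∈-++⁺ʳ _ w∈)) (sym w≡c₁)
  not-central false true w∈ w≡c₂ = All.lookup c₂≢ (∈-++⁺ˡ w∈) (sym w≡c₂)
  not-central true true w∈ w≡c₂ = All.lookup c₂≢ (∈-++⁺ʳ _ w∈) (sym w≡c₂)

  same-leg : ∀ s' s {a b x y} → (a , b) ∈ legsAt S s' → (x , y) ∈ legsAt S s →
    a ≡ x ⊎ b ≡ y → s' ≡ s × (a , b) ≡ (x , y)
  same-leg s' s k k' (inj₁ refl) with side-det s' s (proj₁ (legVerts-∈ k)) (proj₁ (legVerts-∈ k'))
  ... | refl = refl , leg-det (legs-unique s) k k' (inj₁ refl)
  same-leg s' s k k' (inj₂ refl) with side-det s' s (proj₂ (legVerts-∈ k)) (proj₂ (legVerts-∈ k'))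
  ... | refl = refl , leg-det (legs-unique s) k k' (inj₂ refl)

  first≢second : ∀ s' s {a b x y} → (a , b) ∈ legsAt S s' → (x , y) ∈ legsAt S s → a ≢ y
  first≢second s' s k k' refl with side-det s' s (proj₁ (legVerts-∈ k)) (proj₂ (legVerts-∈ k'))
  ... | refl = leg-cross (legs-unique s) k k' refl

  data EdgeShape (r : Edge) : Set where
    central-edge : r ≡ (c₁ , c₂) → EdgeShape r
    inner-edge : ∀ s {a b} → (a , b) ∈ legsAt S s → r ≡ (central S s , a) → EdgeShape r
    outer-edge : ∀ s {a b} → (a , b) ∈ legsAt S s → r ≡ (a , b) → EdgeShape r

  leg-shape : ∀ s {r} → ∃[ a ] ∃[ b ] (a , b) ∈ legsAt S s × (r ≡ (central S s , a) ⊎ r ≡ (a , b)) →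
    EdgeShape r
  leg-shape s (_ , _ , k , inj₁ eq) = inner-edge s k eq
  leg-shape s (_ , _ , k , inj₂ eq) = outer-edge s k eq

  edge-view : ∀ {r} → r ∈ edges S → EdgeShape r
  edge-view (here refl) = central-edge refl
  edge-view (there i) with ∈-++⁻ (legEdges c₁ legs₁) i
  ... | inj₁ i₁ = leg-shape false (legEdges-view c₁ legs₁ i₁)
  ... | inj₂ i₂ = leg-shape true (legEdges-view c₂ legs₂ i₂)

  endpoint-∈ : ∀ {r w} → r ∈ edges S → touches w r → w ∈ vertices S
  endpoint-∈ r∈ t with edge-view r∈ | t
  ... | central-edge refl | inj₁ refl = here refl
  ... | central-edge refl | inj₂ refl = there (here refl)
  ... | inner-edge s k refl | inj₁ refl = central-∈ S s
  ... | inner-edge s k refl | inj₂ refl = legVerts-⊆ s (proj₁ (legVerts-∈ k))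
  ... | outer-edge s k refl | inj₁ refl = legVerts-⊆ s (proj₁ (legVerts-∈ k))
  ... | outer-edge s k refl | inj₂ refl = legVerts-⊆ s (proj₂ (legVerts-∈ k))

  leg-pendant : ∀ s {x y} → (x , y) ∈ legsAt S s → PendantLeg (edges S) (central S s) x y
  leg-pendant s {x} {y} k = record
    { ux∈ = legEdges-⊆ s (proj₁ (legEdges-∈ (central S s) k))
    ; xy∈ = legEdges-⊆ s (proj₂ (legEdges-∈ (central S s) k))
    ; u≢x = λ c≡x → not-central s s x∈ (sym c≡x)
    ; at-x = at-x
    ; at-y = at-y
    }
    where
    x∈ = proj₁ (legVerts-∈ k)
    y∈ = proj₂ (legVerts-∈ k)
    at-x : ∀ r → r ∈ edges S → touches x r → r ≡ (central S s , x) ⊎ r ≡ (x , y)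
    at-x r r∈ t with edge-view r∈ | t
    ... | central-edge refl | inj₁ x≡c₁ = ⊥-elim (not-central s false x∈ x≡c₁)
    ... | central-edge refl | inj₂ x≡c₂ = ⊥-elim (not-central s true x∈ x≡c₂)
    ... | inner-edge s' k' refl | inj₁ x≡c = ⊥-elim (not-central s s' x∈ x≡c)
    ... | inner-edge s' k' refl | inj₂ x≡a with same-leg s' s k' k (inj₁ (sym x≡a))
    ...   | refl , refl = inj₁ refl
    at-x r r∈ t | outer-edge s' k' refl | inj₁ x≡a with same-leg s' s k' k (inj₁ (sym x≡a))
    ...   | refl , refl = inj₂ refl
    at-x r r∈ t | outer-edge s' k' refl | inj₂ x≡b = ⊥-elim (first≢second s s' k k' x≡b)
    at-y : ∀ r → r ∈ edges S → touches y r → r ≡ (x , y)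
    at-y r r∈ t with edge-view r∈ | t
    ... | central-edge refl | inj₁ y≡c₁ = ⊥-elim (not-central s false y∈ y≡c₁)
    ... | central-edge refl | inj₂ y≡c₂ = ⊥-elim (not-central s true y∈ y≡c₂)
    ... | inner-edge s' k' refl | inj₁ y≡c = ⊥-elim (not-central s s' y∈ y≡c)
    ... | inner-edge s' k' refl | inj₂ y≡a = ⊥-elim (first≢second s' s k' k (sym y≡a))
    ... | outer-edge s' k' refl | inj₁ y≡a = ⊥-elim (first≢second s' s k' k (sym y≡a))
    ... | outer-edge s' k' refl | inj₂ y≡b with same-leg s' s k' k (inj₂ (sym y≡b))
    ...   | refl , refl = refl

module Chain (C : SpannerChain) where
  open SpannerChain C

  module Sp (i : ℕ) = SpannerStructure (S i) (proj₂ (proj₂ (proj₂ (spanner i))))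

  spanner-⊆ : ∀ {n m} → n ≤ m → ∀ {r} → r ∈ edges (S n) → r ∈ chainGraph C m
  spanner-⊆ {n} {zero} z≤n r∈ = r∈
  spanner-⊆ {n} {suc m} n≤1+m r∈ with n ℕP.≟ suc m
  ... | yes refl = ∈-++⁺ʳ (chainGraph C m) (there r∈)
  ... | no n≢1+m = ∈-++⁺ˡ (spanner-⊆ (ℕP.≤-pred (ℕP.≤∧≢⇒< n≤1+m n≢1+m)) r∈)

  data ChainEdge (m : ℕ) (r : Edge) : Set where
    in-spanner : ∀ j → r ∈ edges (S j) → ChainEdge m r
    bridge : ∀ i j s t → i ≤ m → j ≤ m → i ≢ j → r ≡ (central (S i) s , central (S j) t) → ChainEdge m r

  chain-view : ∀ m {r} → r ∈ chainGraph C m → ChainEdge m r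
  chain-view zero r∈ = in-spanner 0 r∈
  chain-view (suc m) r∈ with ∈-++⁻ (chainGraph C m) r∈
  ... | inj₁ r∈Gₘ with chain-view m r∈Gₘ
  ...   | in-spanner j r∈Sⱼ = in-spanner j r∈Sⱼ
  ...   | bridge i j s t i≤m j≤m i≢j eq = bridge i j s t (ℕP.m≤n⇒m≤1+n i≤m) (ℕP.m≤n⇒m≤1+n j≤m) i≢j eq
  chain-view (suc m) r∈ | inj₂ (here refl) =
    bridge (attach m) (suc m) (side m) (side' m) (ℕP.m≤n⇒m≤1+n (attach≤ m)) ℕP.≤-refl
      (λ eq → ℕP.1+n≰n (subst (_≤ m) eq (attach≤ m))) refl
  chain-view (suc m) r∈ | inj₂ (there r∈S) = in-spanner (suc m) r∈S

  same-spanner : ∀ i j {v} → v ∈ vertices (S i) → v ∈ vertices (S j) → i ≡ j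
  same-spanner i j v∈Sᵢ v∈Sⱼ with i ℕP.≟ j
  ... | yes i≡j = i≡j
  ... | no i≢j = ⊥-elim (disjoint i j i≢j _ v∈Sᵢ v∈Sⱼ)

  -- a leg vertex of S_i is central in no spanner, so all its edges in G_m belong to S_i
  leg-vertex-local : ∀ i s m {w} → w ∈ legVerts (legsAt (S i) s) → Local (edges (S i)) (chainGraph C m) w
  leg-vertex-local i s m {w} w∈ r r∈ t with chain-view m r∈
  ... | in-spanner j r∈Sⱼ with same-spanner i j (Sp.legVerts-⊆ i s w∈) (Sp.endpoint-∈ j r∈Sⱼ t)
  ...   | refl = r∈Sⱼ
  leg-vertex-local i s m {w} w∈ r r∈ t | bridge a b s′ t′ _ _ _ refl = ⊥-elim (not-central-in t)
    where
    not-central-anywhere : ∀ a s′ → w ≢ central (S a) s′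
    not-central-anywhere a s′ w≡c with same-spanner i a (Sp.legVerts-⊆ i s w∈)
                                         (subst (_∈ vertices (S a)) (sym w≡c) (central-∈ (S a) s′))
    ... | refl = Sp.not-central i s s′ w∈ w≡c
    not-central-in : touches w (central (S a) s′ , central (S b) t′) → ⊥
    not-central-in (inj₁ w≡c) = not-central-anywhere a s′ w≡c
    not-central-in (inj₂ w≡c) = not-central-anywhere b t′ w≡c

  central-legs : ∀ {i m} → i ≤ m → ∀ s → Σ (TwoLegs (chainGraph C m) (central (S i) s)) λ L →
    All (_∈ vertices (S i)) (central (S i) s ∷ TwoLegs.x₁ L ∷ TwoLegs.x₂ L ∷ [])
  central-legs {i} {m} i≤m s with two-legs (legsAt (S i) s) (enough-legs s) (Sp.legs-unique i s)
    where
    enough-legs : ∀ s → 2 ≤ length (legsAt (S i) s)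
    enough-legs false = proj₁ (spanner i)
    enough-legs true = proj₁ (proj₂ (spanner i))
  ... | x₁ , y₁ , x₂ , y₂ , x₁≢x₂ , k₁ , k₂ =
    record { x₁ = x₁ ; y₁ = y₁ ; x₂ = x₂ ; y₂ = y₂ ; x₁≢x₂ = x₁≢x₂
           ; leg₁ = chain-leg k₁ ; leg₂ = chain-leg k₂ } ,
    central-∈ (S i) s ∷ in-Sᵢ k₁ ∷ in-Sᵢ k₂ ∷ []
    where
    chain-leg : ∀ {x y} → (x , y) ∈ legsAt (S i) s → PendantLeg (chainGraph C m) (central (S i) s) x y
    chain-leg k = pendant-extend (spanner-⊆ i≤m)
      (leg-vertex-local i s m (proj₁ (legVerts-∈ k))) (leg-vertex-local i s m (proj₂ (legVerts-∈ k)))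
      (Sp.leg-pendant i s k)
    in-Sᵢ : ∀ {x y} → (x , y) ∈ legsAt (S i) s → x ∈ vertices (S i)
    in-Sᵢ k = Sp.legVerts-⊆ i s (proj₁ (legVerts-∈ k))

  edges-in-spanners : ∀ m {H H'} → InΛ (chainGraph C m) H H' → ∀ {r} → r ∈ H → ∃[ j ] r ∈ edges (S j)
  edges-in-spanners m opt r∈H with chain-view m (All.lookup (proj₁ (proj₁ (proj₁ opt))) r∈H)
  ... | in-spanner j r∈Sⱼ = j , r∈Sⱼ
  ... | bridge i j s t i≤m j≤m i≢j refl = ⊥-elim (bridge-unused opt Lu Lv v∉legs r∈H)
    where
    Lu : TwoLegs (chainGraph C m) (central (S i) s)
    Lu = proj₁ (central-legs i≤m s)
    Lv : TwoLegs (chainGraph C m) (central (S j) t)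
    Lv = proj₁ (central-legs j≤m t)
    v∉legs : central (S j) t ∉ central (S i) s ∷ TwoLegs.x₁ Lu ∷ TwoLegs.x₂ Lu ∷ []
    v∉legs v∈ = i≢j (same-spanner i j (All.lookup (proj₂ (central-legs i≤m s)) v∈) (central-∈ (S j) t))

  spanner-separated : ∀ m {H H'} → InΛ (chainGraph C m) H H' → ∀ n → Separated (edges (S n)) H
  spanner-separated m {H} opt n {a} {b} a∈Sₙ b∈outside = vdisjoint-intro a b apart
    where
    b∈H : b ∈ H
    b∈H = proj₁ (outside-⊆ (edges (S n)) H b∈outside)
    b∉Sₙ : b ∉ edges (S n)
    b∉Sₙ = proj₂ (outside-⊆ (edges (S n)) H b∈outside)
    apart : ∀ w → touches w a → touches w b → ⊥
    apart w ta tb with edges-in-spanners m opt b∈H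
    ... | j , b∈Sⱼ with same-spanner n j (Sp.endpoint-∈ n a∈Sₙ ta) (Sp.endpoint-∈ j b∈Sⱼ tb)
    ...   | refl = b∉Sₙ b∈Sⱼ

-- E(S_n) ⊆ G_m is separated from both H and H' (using the symmetry of Λ), so the
-- restriction lemma applies with F = E(S_n).
lemma3p7 : (C : SpannerChain) (m : ℕ) (H H' : List Edge) →
    InΛμ (chainGraph C m) H H' →
    ∀ n → n ≤ m →
      InΛμ (edges (SpannerChain.S C n)) (H ∩E edges (SpannerChain.S C n)) (H' ∩E edges (SpannerChain.S C n))
lemma3p7 C m H H' opt n n≤m = restrict-Λμ opt
  where
  open Chain C
  Λ-opt : InΛ (chainGraph C m) H H'
  Λ-opt = proj₁ opt
  open Restriction (spanner-⊆ n≤m) {H} {H'}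
         (spanner-separated m Λ-opt n) (spanner-separated m (swapΛ _ H H' Λ-opt) n)
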